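{- Let $G$ be a finite simple $r$-regular graph of order $n$ and let $p$ be an integer with $0 \leq p \leq r$. Then \[ \alpha_p(G) \leq \frac{nr}{2r-p}, \] and this bound is sharp (for such $r,p$ there exist $r$-regular graphs attaining equality). If in addition $p < r$, then \[ \alpha_p(G) \leq \frac{nr}{r+1}. \]
   Context: For a graph $G$ and a non-negative integer $p$, a set $S \subseteq V(G)$ is $p$-independent if the subgraph induced by $S$ has maximum degree at most $p$; $\alpha_p(G)$ denotes the maximum cardinality of a $p$-independent set of $G$. -}

module Defs where

open import Data.Nat using (ℕ; _≤_)
open import Data.Bool using (Bool; false)
open import Data.Fin using (Fin)
open import Data.Fin.Subset using (Subset; _∈_; _∩_; ∣_∣)
open import Data.Vec using (tabulate)
open import Data.Product using (Σ; _×_)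
open import Relation.Binary.PropositionalEquality using (_≡_)

record Graph (n : ℕ) : Set where
  field
    adj   : Fin n → Fin n → Bool
    sym   : ∀ u v → adj u v ≡ adj v u
    loopless : ∀ v → adj v v ≡ false
open Graph public

N : ∀ {n} → Graph n → Fin n → Subset n
N G v = tabulate (adj G v)

deg : ∀ {n} → Graph n → Fin n → ℕ
deg G v = ∣ N G v ∣

Regular : ∀ {n} → ℕ → Graph n → Set
Regular r G = ∀ v → deg G v ≡ r

degIn : ∀ {n} → Graph n → Subset n → Fin n → ℕ
degIn G S v = ∣ S ∩ N G v ∣

PIndependent : ∀ {n} → Graph n → ℕ → Subset n → Set
PIndependent G p S = ∀ v → v ∈ S → degIn G S v ≤ p

IsAlpha : ∀ {n} → Graph n → ℕ → ℕ → Set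
IsAlpha G p k =
  Σ (Subset _) (λ S → PIndependent G p S × ∣ S ∣ ≡ k)
  × (∀ S → PIndependent G p S → ∣ S ∣ ≤ k)

-- Double counting the edges between a p-independent set S and its complement: each vertex
-- of S has at most p of its r neighbours in S, so it sends at least r − p edges out, while
-- each of the n − |S| vertices outside S receives at most r.  Hence |S| (r − p) ≤ (n − |S|) r.
module Submission where

open import Defs hiding (sym)
open import Data.Bool using (Bool; true; false; not; _∧_)
open import Data.Fin using (Fin; zero; suc; _↑ˡ_; _↑ʳ_; splitAt; remQuot; combine)
open import Data.Fin.Properties using (_≟_; remQuot-combine)
open import Data.Fin.Subset using (Subset; _∩_; ∁; ∣_∣)
open import Data.Fin.Subset.Properties using (∣p∣≤n; ∣∁p∣≡n∸∣p∣; ∣p∩q∣≤∣q∣)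
open import Data.Nat using (ℕ; zero; suc; _+_; _*_; _∸_; _≤_; _<_; z≤n; s≤s; >-nonZero)
open import Data.Nat.Properties
  using ( +-assoc; +-comm; +-suc; +-identityʳ; *-identityʳ; *-distribˡ-+; *-distribʳ-+
        ; ≤-trans; ≤-reflexive; <⇒≤; +-mono-≤; +-monoˡ-≤; *-monoʳ-≤; *-cancelʳ-≤
        ; m≤m+n; m≤n+m; +-∸-comm; m∸n+n≡m; m+[n∸m]≡n; m≤n+o⇒m∸n≤o; m<n⇒0<n∸m
        ; +-*-semiring; module ≤-Reasoning )
open import Algebra.Properties.Semiring.Sum +-*-semiring
  using (sum-syntax; sum-cong-≗; sum-replicate-zero; ∑-distrib-+; ∑-comm; *-distribˡ-sum; *-distribʳ-sum)
open import Data.Nat.Tactic.RingSolver using (solve-∀)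
open import Data.Product using (Σ; _×_; _,_)
import Data.Product as Product
open import Data.Sum using (_⊎_; inj₁; inj₂)
import Data.Sum as Sum
open import Data.Vec using ([]; _∷_; lookup; tabulate)
open import Data.Vec.Properties using (lookup-zipWith; lookup∘tabulate; lookup⇒[]=; []=⇒lookup)
open import Function using (_∘_)
open import Relation.Nullary using (does; yes; no)
open import Relation.Nullary.Decidable using (dec-true; dec-false)
open import Relation.Binary.PropositionalEquality

indicator : Bool → ℕ
indicator true  = 1
indicator false = 0

indicator-*-mono-≤ : ∀ b {m n} → (b ≡ true → m ≤ n) → indicator b * m ≤ indicator b * n
indicator-*-mono-≤ true  m≤n = +-monoˡ-≤ 0 (m≤n refl)
indicator-*-mono-≤ false _   = z≤n

∑-const : ∀ n c → ∑[ i < n ] c ≡ n * c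
∑-const zero    c = refl
∑-const (suc n) c = cong (c +_) (∑-const n c)

∑-mono-≤ : ∀ {n} {f g : Fin n → ℕ} → (∀ i → f i ≤ g i) → ∑[ i < n ] f i ≤ ∑[ i < n ] g i
∑-mono-≤ {zero}  _   = z≤n
∑-mono-≤ {suc n} f≤g = +-mono-≤ (f≤g zero) (∑-mono-≤ (f≤g ∘ suc))

∑-↑ : ∀ m n (f : Fin (m + n) → ℕ) →
  ∑[ k < m + n ] f k ≡ ∑[ i < m ] f (i ↑ˡ n) + ∑[ j < n ] f (m ↑ʳ j)
∑-↑ zero    n f = refl
∑-↑ (suc m) n f = trans (cong (f zero +_) (∑-↑ m n (f ∘ suc))) (sym (+-assoc (f zero) _ _))

∑-splitAt : ∀ m n (g : Fin m ⊎ Fin n → ℕ) →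
  ∑[ k < m + n ] g (splitAt m k) ≡ ∑[ i < m ] g (inj₁ i) + ∑[ j < n ] g (inj₂ j)
∑-splitAt zero    n g = refl
∑-splitAt (suc m) n g =
  trans (cong (g (inj₁ zero) +_) (∑-splitAt m n (g ∘ Sum.map₁ suc))) (sym (+-assoc (g (inj₁ zero)) _ _))

∑-combine : ∀ m n (f : Fin (m * n) → ℕ) → ∑[ k < m * n ] f k ≡ ∑[ i < m ] ∑[ j < n ] f (combine i j)
∑-combine zero    n f = refl
∑-combine (suc m) n f = trans (∑-↑ n (m * n) f) (cong (∑[ j < n ] f (j ↑ˡ (m * n)) +_) (∑-combine m n (f ∘ (n ↑ʳ_))))

∑-remQuot : ∀ m n (g : Fin m × Fin n → ℕ) → ∑[ k < m * n ] g (remQuot n k) ≡ ∑[ i < m ] ∑[ j < n ] g (i , j)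
∑-remQuot m n g = trans (∑-combine m n (g ∘ remQuot n))
  (sum-cong-≗ λ i → sum-cong-≗ λ j → cong g (remQuot-combine i j))

∑-δ : ∀ {n} (x : Fin n) → ∑[ y < n ] indicator (does (x ≟ y)) ≡ 1
∑-δ {suc n} zero    = cong suc (sum-replicate-zero n)
∑-δ {suc n} (suc x) = ∑-δ x

∑-not-δ : ∀ {n} (x : Fin (suc n)) → ∑[ y < suc n ] indicator (not (does (x ≟ y))) ≡ n
∑-not-δ {n}     zero    = trans (∑-const n 1) (*-identityʳ n)
∑-not-δ {suc n} (suc x) = cong suc (∑-not-δ x)

∑-∧-δ : ∀ {n} b (i : Fin n) → ∑[ j < n ] indicator (b ∧ does (i ≟ j)) ≡ indicator b
∑-∧-δ     true  i = ∑-δ i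
∑-∧-δ {n} false i = sum-replicate-zero n

∑∑-δ : ∀ {n} (x : Fin n) m → ∑[ y < n ] ∑[ k < m ] indicator (does (x ≟ y)) ≡ m
∑∑-δ {n} x m = begin
  ∑[ y < n ] ∑[ k < m ] indicator (does (x ≟ y))   ≡⟨ sum-cong-≗ (λ y → ∑-const m (indicator (does (x ≟ y)))) ⟩
  ∑[ y < n ] (m * indicator (does (x ≟ y)))         ≡⟨ sym (*-distribˡ-sum m (λ y → indicator (does (x ≟ y)))) ⟩
  m * ∑[ y < n ] indicator (does (x ≟ y))           ≡⟨ cong (m *_) (∑-δ x) ⟩
  m * 1                                             ≡⟨ *-identityʳ m ⟩
  m                                                 ∎
  where open ≡-Reasoning

does-≟-comm : ∀ {n} (x y : Fin n) → does (x ≟ y) ≡ does (y ≟ x)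
does-≟-comm x y with x ≟ y
... | yes x≡y = sym (dec-true (y ≟ x) (sym x≡y))
... | no  x≢y = sym (dec-false (y ≟ x) (x≢y ∘ sym))

∣p∣≡∑ : ∀ {n} (p : Subset n) → ∣ p ∣ ≡ ∑[ i < n ] indicator (lookup p i)
∣p∣≡∑ []          = refl
∣p∣≡∑ (true ∷ p)  = cong suc (∣p∣≡∑ p)
∣p∣≡∑ (false ∷ p) = ∣p∣≡∑ p

∣tabulate∣≡∑ : ∀ {n} (f : Fin n → Bool) → ∣ tabulate f ∣ ≡ ∑[ i < n ] indicator (f i)
∣tabulate∣≡∑ f = trans (∣p∣≡∑ (tabulate f)) (sum-cong-≗ (cong indicator ∘ lookup∘tabulate f))

∑-indicator-* : ∀ {n} (p : Subset n) c → ∑[ i < n ] (indicator (lookup p i) * c) ≡ ∣ p ∣ * c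
∑-indicator-* p c = trans (sym (*-distribʳ-sum c (indicator ∘ lookup p))) (cong (_* c) (sym (∣p∣≡∑ p)))

∣∁p∣+∣p∣≡n : ∀ {n} (p : Subset n) → ∣ ∁ p ∣ + ∣ p ∣ ≡ n
∣∁p∣+∣p∣≡n p = trans (cong (_+ ∣ p ∣) (∣∁p∣≡n∸∣p∣ p)) (m∸n+n≡m (∣p∣≤n p))

∣p∩q∣+∣∁p∩q∣≡∣q∣ : ∀ {n} (p q : Subset n) → ∣ p ∩ q ∣ + ∣ ∁ p ∩ q ∣ ≡ ∣ q ∣
∣p∩q∣+∣∁p∩q∣≡∣q∣ []          []          = refl
∣p∩q∣+∣∁p∩q∣≡∣q∣ (true ∷ p)  (true ∷ q)  = cong suc (∣p∩q∣+∣∁p∩q∣≡∣q∣ p q)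
∣p∩q∣+∣∁p∩q∣≡∣q∣ (true ∷ p)  (false ∷ q) = ∣p∩q∣+∣∁p∩q∣≡∣q∣ p q
∣p∩q∣+∣∁p∩q∣≡∣q∣ (false ∷ p) (true ∷ q)  = trans (+-suc _ _) (cong suc (∣p∩q∣+∣∁p∩q∣≡∣q∣ p q))
∣p∩q∣+∣∁p∩q∣≡∣q∣ (false ∷ p) (false ∷ q) = ∣p∩q∣+∣∁p∩q∣≡∣q∣ p q

degIn≡∑ : ∀ {n} (G : Graph n) S v → degIn G S v ≡ ∑[ w < n ] indicator (lookup S w ∧ adj G v w)
degIn≡∑ G S v = trans (∣p∣≡∑ (S ∩ N G v)) (sum-cong-≗ λ w → cong indicator
  (trans (lookup-zipWith _∧_ w S (N G v)) (cong (lookup S w ∧_) (lookup∘tabulate (adj G v) w))))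

edgesBetween : ∀ {n} → Graph n → Subset n → Subset n → ℕ
edgesBetween {n} G A B = ∑[ v < n ] (indicator (lookup A v) * degIn G B v)

edgesBetween-comm : ∀ {n} (G : Graph n) A B → edgesBetween G A B ≡ edgesBetween G B A
edgesBetween-comm {n} G A B = begin
  ∑[ v < n ] (indicator (lookup A v) * degIn G B v)
    ≡⟨ sum-cong-≗ (λ v → cong (indicator (lookup A v) *_) (degIn≡∑ G B v)) ⟩
  ∑[ v < n ] (indicator (lookup A v) * ∑[ w < n ] indicator (lookup B w ∧ adj G v w))
    ≡⟨ sum-cong-≗ (λ v → *-distribˡ-sum (indicator (lookup A v)) (λ w → indicator (lookup B w ∧ adj G v w))) ⟩
  ∑[ v < n ] ∑[ w < n ] (indicator (lookup A v) * indicator (lookup B w ∧ adj G v w))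
    ≡⟨ sum-cong-≗ (λ v → sum-cong-≗ (λ w → swap (lookup A v) (lookup B w) (Graph.sym G v w))) ⟩
  ∑[ v < n ] ∑[ w < n ] (indicator (lookup B w) * indicator (lookup A v ∧ adj G w v))
    ≡⟨ ∑-comm (λ v w → indicator (lookup B w) * indicator (lookup A v ∧ adj G w v)) ⟩
  ∑[ w < n ] ∑[ v < n ] (indicator (lookup B w) * indicator (lookup A v ∧ adj G w v))
    ≡⟨ sum-cong-≗ (λ w → sym (*-distribˡ-sum (indicator (lookup B w)) (λ v → indicator (lookup A v ∧ adj G w v)))) ⟩
  ∑[ w < n ] (indicator (lookup B w) * ∑[ v < n ] indicator (lookup A v ∧ adj G w v))
    ≡⟨ sum-cong-≗ (λ w → cong (indicator (lookup B w) *_) (sym (degIn≡∑ G A w))) ⟩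
  ∑[ w < n ] (indicator (lookup B w) * degIn G A w) ∎
  where
  open ≡-Reasoning
  swap : ∀ a b {e e′} → e ≡ e′ → indicator a * indicator (b ∧ e) ≡ indicator b * indicator (a ∧ e′)
  swap true  true  refl = refl
  swap true  false refl = refl
  swap false true  refl = refl
  swap false false refl = refl

2*r∸p≡r∸p+r : ∀ {r p} → p ≤ r → 2 * r ∸ p ≡ r ∸ p + r
2*r∸p≡r∸p+r {r} {p} p≤r = trans (cong (λ s → r + s ∸ p) (+-identityʳ r)) (+-∸-comm r p≤r)

module _ {n r} (G : Graph n) (regular : Regular r G) where

  degIn+degIn∁≡r : ∀ S v → degIn G S v + degIn G (∁ S) v ≡ r
  degIn+degIn∁≡r S v = trans (∣p∩q∣+∣∁p∩q∣≡∣q∣ S (N G v)) (regular v)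

  edgesBetween≤∣A∣*r : ∀ A B → edgesBetween G A B ≤ ∣ A ∣ * r
  edgesBetween≤∣A∣*r A B = ≤-trans
    (∑-mono-≤ λ v → *-monoʳ-≤ (indicator (lookup A v)) (≤-trans (∣p∩q∣≤∣q∣ B (N G v)) (≤-reflexive (regular v))))
    (≤-reflexive (∑-indicator-* A r))

  ∣S∣*[r∸p]≤edgesBetween : ∀ {p S} → PIndependent G p S → ∣ S ∣ * (r ∸ p) ≤ edgesBetween G S (∁ S)
  ∣S∣*[r∸p]≤edgesBetween {p} {S} independent = ≤-trans
    (≤-reflexive (sym (∑-indicator-* S (r ∸ p))))
    (∑-mono-≤ λ v → indicator-*-mono-≤ (lookup S v) (r∸p≤outDegree v))
    where
    r∸p≤outDegree : ∀ v → lookup S v ≡ true → r ∸ p ≤ degIn G (∁ S) v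
    r∸p≤outDegree v v∈S = m≤n+o⇒m∸n≤o r p (begin
      r                                   ≡⟨ sym (degIn+degIn∁≡r S v) ⟩
      degIn G S v + degIn G (∁ S) v       ≤⟨ +-monoˡ-≤ _ (independent v (lookup⇒[]= v S v∈S)) ⟩
      p + degIn G (∁ S) v                 ∎)
      where open ≤-Reasoning

  pIndependent-bound : ∀ {p S} → p ≤ r → PIndependent G p S → ∣ S ∣ * (2 * r ∸ p) ≤ n * r
  pIndependent-bound {p} {S} p≤r independent = begin
    ∣ S ∣ * (2 * r ∸ p)                   ≡⟨ cong (∣ S ∣ *_) (2*r∸p≡r∸p+r p≤r) ⟩
    ∣ S ∣ * (r ∸ p + r)                   ≡⟨ *-distribˡ-+ ∣ S ∣ (r ∸ p) r ⟩
    ∣ S ∣ * (r ∸ p) + ∣ S ∣ * r           ≤⟨ +-monoˡ-≤ _ (∣S∣*[r∸p]≤edgesBetween independent) ⟩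
    edgesBetween G S (∁ S) + ∣ S ∣ * r    ≡⟨ cong (_+ ∣ S ∣ * r) (edgesBetween-comm G S (∁ S)) ⟩
    edgesBetween G (∁ S) S + ∣ S ∣ * r    ≤⟨ +-monoˡ-≤ _ (edgesBetween≤∣A∣*r (∁ S) S) ⟩
    ∣ ∁ S ∣ * r + ∣ S ∣ * r               ≡⟨ sym (*-distribʳ-+ r ∣ ∁ S ∣ ∣ S ∣) ⟩
    (∣ ∁ S ∣ + ∣ S ∣) * r                 ≡⟨ cong (_* r) (∣∁p∣+∣p∣≡n S) ⟩
    n * r                                 ∎
    where open ≤-Reasoning

  attains-bound⇒IsAlpha : ∀ {p S} → p ≤ r → 0 < r → PIndependent G p S →
    ∣ S ∣ * (2 * r ∸ p) ≡ n * r → IsAlpha G p ∣ S ∣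
  attains-bound⇒IsAlpha {p} {S} p≤r 0<r independent attains = (S , independent , refl) , maximum
    where
    0<2*r∸p : 0 < 2 * r ∸ p
    0<2*r∸p = ≤-trans 0<r (≤-trans (m≤n+m r (r ∸ p)) (≤-reflexive (sym (2*r∸p≡r∸p+r p≤r))))
    maximum : ∀ S′ → PIndependent G p S′ → ∣ S′ ∣ ≤ ∣ S ∣
    maximum S′ independent′ = *-cancelʳ-≤ ∣ S′ ∣ ∣ S ∣ (2 * r ∸ p) {{>-nonZero 0<2*r∸p}}
      (≤-trans (pIndependent-bound p≤r independent′) (≤-reflexive (sym attains)))

-- The extremal graph: p + 1 disjoint copies of K_{r, r−p}, with the i-th vertices of the
-- r-sides of all copies joined into a clique K_{p+1}.  The r-sides form a p-independent set.
module Extremal {p r : ℕ} (p≤r : p ≤ r) where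

  Vertex : Set
  Vertex = Fin (suc p) × (Fin r ⊎ Fin (r ∸ p))

  adjacent : Vertex → Vertex → Bool
  adjacent (x , inj₁ i) (y , inj₁ j) = not (does (x ≟ y)) ∧ does (i ≟ j)
  adjacent (x , inj₁ _) (y , inj₂ _) = does (x ≟ y)
  adjacent (x , inj₂ _) (y , inj₁ _) = does (x ≟ y)
  adjacent (_ , inj₂ _) (_ , inj₂ _) = false

  isInner : Vertex → Bool
  isInner (_ , inj₁ _) = true
  isInner (_ , inj₂ _) = false

  ∑inner ∑outer : (Vertex → ℕ) → ℕ
  ∑inner f = ∑[ x < suc p ] ∑[ i < r ] f (x , inj₁ i)
  ∑outer f = ∑[ x < suc p ] ∑[ k < r ∸ p ] f (x , inj₂ k)

  order : ℕ
  order = suc p * (r + (r ∸ p))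

  decode : Fin order → Vertex
  decode v = Product.map₂ (splitAt r) (remQuot (r + (r ∸ p)) v)

  ∑-decode : ∀ f → ∑[ v < order ] f (decode v) ≡ ∑inner f + ∑outer f
  ∑-decode f = begin
    ∑[ v < order ] f (decode v)
      ≡⟨ ∑-remQuot (suc p) (r + (r ∸ p)) (λ (x , j) → f (x , splitAt r j)) ⟩
    ∑[ x < suc p ] ∑[ j < r + (r ∸ p) ] f (x , splitAt r j)
      ≡⟨ sum-cong-≗ (λ x → ∑-splitAt r (r ∸ p) (λ j → f (x , j))) ⟩
    ∑[ x < suc p ] (∑[ i < r ] f (x , inj₁ i) + ∑[ k < r ∸ p ] f (x , inj₂ k))
      ≡⟨ ∑-distrib-+ (λ x → ∑[ i < r ] f (x , inj₁ i)) (λ x → ∑[ k < r ∸ p ] f (x , inj₂ k)) ⟩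
    ∑inner f + ∑outer f ∎
    where open ≡-Reasoning

  ∣tabulate∘decode∣ : ∀ g → ∣ tabulate (g ∘ decode) ∣ ≡ ∑inner (indicator ∘ g) + ∑outer (indicator ∘ g)
  ∣tabulate∘decode∣ g = trans (∣tabulate∣≡∑ (g ∘ decode)) (∑-decode (indicator ∘ g))

  graph : Graph order
  graph = record
    { adj      = λ u v → adjacent (decode u) (decode v)
    ; sym      = λ u v → adjacent-comm (decode u) (decode v)
    ; loopless = λ v → adjacent-irrefl (decode v)
    }
    where
    adjacent-comm : ∀ u v → adjacent u v ≡ adjacent v u
    adjacent-comm (x , inj₁ i) (y , inj₁ j) = cong₂ (λ a b → not a ∧ b) (does-≟-comm x y) (does-≟-comm i j)
    adjacent-comm (x , inj₁ _) (y , inj₂ _) = does-≟-comm x y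
    adjacent-comm (x , inj₂ _) (y , inj₁ _) = does-≟-comm x y
    adjacent-comm (_ , inj₂ _) (_ , inj₂ _) = refl
    adjacent-irrefl : ∀ u → adjacent u u ≡ false
    adjacent-irrefl (x , inj₁ _) = cong (λ b → not b ∧ _) (dec-true (x ≟ x) refl)
    adjacent-irrefl (_ , inj₂ _) = refl

  inner : Subset order
  inner = tabulate (isInner ∘ decode)

  #innerNeighbours #outerNeighbours : Vertex → ℕ
  #innerNeighbours u = ∑inner (indicator ∘ adjacent u)
  #outerNeighbours u = ∑outer (indicator ∘ adjacent u)

  ∑outer-zero : ∑outer (λ _ → 0) ≡ 0
  ∑outer-zero = trans (cong (λ c → ∑[ x < suc p ] c) (sum-replicate-zero (r ∸ p))) (sum-replicate-zero (suc p))

  #innerNeighbours-inner : ∀ x i → #innerNeighbours (x , inj₁ i) ≡ p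
  #innerNeighbours-inner x i = trans (sum-cong-≗ λ y → ∑-∧-δ (not (does (x ≟ y))) i) (∑-not-δ x)

  degree : ∀ u → #innerNeighbours u + #outerNeighbours u ≡ r
  degree (x , inj₁ i) = trans (cong₂ _+_ (#innerNeighbours-inner x i) (∑∑-δ x (r ∸ p))) (m+[n∸m]≡n p≤r)
  degree (x , inj₂ _) = trans (cong₂ _+_ (∑∑-δ x r) ∑outer-zero) (+-identityʳ r)

  regular : Regular r graph
  regular v = trans (∣tabulate∘decode∣ (adjacent (decode v))) (degree (decode v))

  degIn-inner : ∀ v → degIn graph inner v ≡ #innerNeighbours (decode v)
  degIn-inner v = begin
    degIn graph inner v
      ≡⟨ degIn≡∑ graph inner v ⟩
    ∑[ w < order ] indicator (lookup inner w ∧ adjacent (decode v) (decode w))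
      ≡⟨ sum-cong-≗ (λ w → cong (λ b → indicator (b ∧ adjacent (decode v) (decode w))) (lookup∘tabulate (isInner ∘ decode) w)) ⟩
    ∑[ w < order ] indicator (isInner (decode w) ∧ adjacent (decode v) (decode w))
      ≡⟨ ∑-decode (λ u → indicator (isInner u ∧ adjacent (decode v) u)) ⟩
    #innerNeighbours (decode v) + ∑outer (λ _ → 0)
      ≡⟨ trans (cong (#innerNeighbours (decode v) +_) ∑outer-zero) (+-identityʳ _) ⟩
    #innerNeighbours (decode v) ∎
    where open ≡-Reasoning

  independent : PIndependent graph p inner
  independent v v∈inner =
    ≤-trans (≤-reflexive (degIn-inner v)) (#innerNeighbours≤p (decode v) decode-v-isInner)
    where
    decode-v-isInner : isInner (decode v) ≡ true
    decode-v-isInner = trans (sym (lookup∘tabulate (isInner ∘ decode) v)) ([]=⇒lookup v∈inner)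
    #innerNeighbours≤p : ∀ u → isInner u ≡ true → #innerNeighbours u ≤ p
    #innerNeighbours≤p (x , inj₁ i) _ = ≤-reflexive (#innerNeighbours-inner x i)

  ∣inner∣ : ∣ inner ∣ ≡ suc p * r
  ∣inner∣ = begin
    ∣ inner ∣                            ≡⟨ ∣tabulate∘decode∣ isInner ⟩
    ∑inner (λ _ → 1) + ∑outer (λ _ → 0)  ≡⟨ cong₂ _+_ (cong (λ c → ∑[ x < suc p ] c) (∑-const r 1)) ∑outer-zero ⟩
    ∑[ x < suc p ] (r * 1) + 0           ≡⟨ trans (+-identityʳ _) (∑-const (suc p) (r * 1)) ⟩
    suc p * (r * 1)                      ≡⟨ cong (suc p *_) (*-identityʳ r) ⟩
    suc p * r                            ∎
    where open ≡-Reasoning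

  inner-attains-bound : ∣ inner ∣ * (2 * r ∸ p) ≡ order * r
  inner-attains-bound = begin
    ∣ inner ∣ * (2 * r ∸ p)              ≡⟨ cong₂ _*_ ∣inner∣ (2*r∸p≡r∸p+r p≤r) ⟩
    suc p * r * (r ∸ p + r)              ≡⟨ rearrange (suc p) r (r ∸ p) ⟩
    suc p * (r + (r ∸ p)) * r            ∎
    where
    open ≡-Reasoning
    rearrange : ∀ a b c → a * b * (c + b) ≡ a * (b + c) * b
    rearrange = solve-∀

  0<order : 0 < r → 0 < order
  0<order 0<r = ≤-trans 0<r (≤-trans (m≤m+n r (r ∸ p)) (m≤m+n (r + (r ∸ p)) (p * (r + (r ∸ p)))))

K₁ : Graph 1
K₁ = record { adj = λ _ _ → false ; sym = λ _ _ → refl ; loopless = λ _ → refl }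

α-bound-sharp : ∀ r p → p ≤ r → Σ ℕ λ n → Σ (Graph n) λ G → Σ ℕ λ k →
  0 < n × Regular r G × IsAlpha G p k × k * (2 * r ∸ p) ≡ n * r
-- For r = 0 the graph of Extremal has no vertices, so K₁ is used instead.
α-bound-sharp zero .zero z≤n =
  1 , K₁ , 1 , s≤s z≤n , (λ _ → refl) , ((true ∷ [] , (λ _ _ → z≤n) , refl) , λ S _ → ∣p∣≤n S) , refl
α-bound-sharp r@(suc _) p p≤r =
  order , graph , ∣ inner ∣ , 0<order 0<r , regular ,
  attains-bound⇒IsAlpha graph regular p≤r 0<r independent inner-attains-bound , inner-attains-bound
  where
  open Extremal p≤r
  0<r : 0 < r
  0<r = s≤s z≤n

r+1≤2*r∸p : ∀ {r p} → p < r → r + 1 ≤ 2 * r ∸ p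
r+1≤2*r∸p {r} {p} p<r = begin
  r + 1        ≡⟨ +-comm r 1 ⟩
  1 + r        ≤⟨ +-monoˡ-≤ r (m<n⇒0<n∸m p<r) ⟩
  r ∸ p + r    ≡⟨ sym (2*r∸p≡r∸p+r (<⇒≤ p<r)) ⟩
  2 * r ∸ p    ∎
  where open ≤-Reasoning

α-bound : (n r p k : ℕ) (G : Graph n) → Regular r G → p ≤ r → IsAlpha G p k →
  k * (2 * r ∸ p) ≤ n * r
α-bound n r p k G regular p≤r ((S , independent , refl) , _) = pIndependent-bound G regular p≤r independent

α-bound-p<r : (n r p k : ℕ) (G : Graph n) → Regular r G → p < r → IsAlpha G p k →
  k * (r + 1) ≤ n * r
α-bound-p<r n r p k G regular p<r α =
  ≤-trans (*-monoʳ-≤ k (r+1≤2*r∸p p<r)) (α-bound n r p k G regular (<⇒≤ p<r) α)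

lemma4 :
    ((n r p k : ℕ) (G : Graph n) → Regular r G → p ≤ r → IsAlpha G p k →
      k * (2 * r ∸ p) ≤ n * r)
    × ((r p : ℕ) → p ≤ r →
      Σ ℕ (λ n → Σ (Graph n) (λ G → Σ ℕ (λ k →
        0 < n × Regular r G × IsAlpha G p k × k * (2 * r ∸ p) ≡ n * r))))
    × ((n r p k : ℕ) (G : Graph n) → Regular r G → p < r → IsAlpha G p k →
      k * (r + 1) ≤ n * r)
lemma4 = α-bound , α-bound-sharp , α-bound-p<r
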